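{- Let $d\ge 2$ and $n,k\ge 0$ be integers. Then $N_d(n,k)$ equals the number of trees in $\mathcal{T}_d$ with $(n-k)(d-1)+k+1$ edges and $k+1$ internal nodes.
   Context: $N_d(n,k) = \frac{1}{n+1} \binom{n+1}{k+1} \binom{ n + (n-k)(d-2)+1}{k}$. An ordered tree is a rooted unlabelled tree in which the children of each vertex are linearly ordered. The outdegree of a vertex is its number of children; leaves have outdegree $0$, internal nodes have positive outdegree. $\mathcal{T}_d$ is the set of ordered trees with at least one internal node in which the outdegree of every internal node is congruent to $1$ modulo $d-1$. -}

module Defs where

open import Data.Nat using (ℕ; zero; suc; _+_; _*_; _∸_; _≤_)
open import Data.Nat.Divisibility using (_∣_)
open import Data.Nat.Combinatorics using (_C_)
open import Data.Integer as ℤ using (ℤ; +_)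
open import Data.List using (List; []; _∷_; length)
open import Data.Product using (Σ; _×_)
open import Data.Unit using (⊤)
open import Relation.Binary.PropositionalEquality using (_≡_)

data Tree : Set where
  node : List Tree → Tree

outdeg : Tree → ℕ
outdeg (node cs) = length cs

mutual
  edges : Tree → ℕ
  edges (node cs) = length cs + edgesL cs

  edgesL : List Tree → ℕ
  edgesL []       = 0
  edgesL (t ∷ ts) = edges t + edgesL ts

mutual
  internal : Tree → ℕ
  internal (node [])         = 0
  internal (node cs@(_ ∷ _)) = suc (internalL cs)

  internalL : List Tree → ℕ
  internalL []       = 0
  internalL (t ∷ ts) = internal t + internalL ts

mutual
  AllInternalOK : ℕ → Tree → Set
  AllInternalOK d (node [])         = ⊤
  AllInternalOK d (node cs@(_ ∷ _)) = ((d ∸ 1) ∣ (length cs ∸ 1)) × AllInternalOKL d cs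

  AllInternalOKL : ℕ → List Tree → Set
  AllInternalOKL d []       = ⊤
  AllInternalOKL d (t ∷ ts) = AllInternalOK d t × AllInternalOKL d ts

InT : ℕ → Tree → Set
InT d t = (1 ≤ internal t) × AllInternalOK d t

TreesWith : ℕ → ℕ → ℕ → Set
TreesWith d n k =
  Σ Tree λ t →
    InT d t
    × (+ edges t ≡ (((+ n) ℤ.- (+ k)) ℤ.* ((+ d) ℤ.- (+ 1))) ℤ.+ (+ k) ℤ.+ (+ 1))
    × (internal t ≡ suc k)

-- (n+1) * N_d(n,k) = C(n+1,k+1) * C(n + (n-k)(d-2) + 1, k).
-- (When k > n the first factor is 0, so the truncated subtraction in the
-- second binomial's top argument is irrelevant.)
NdNumerator : ℕ → ℕ → ℕ → ℕ
NdNumerator d n k = (suc n C suc k) * ((n + (n ∸ k) * (d ∸ 2) + 1) C k)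

module Submission where

-- Write e = d - 1.  Give a node with 1 + e a children excess a; then a tree of 𝒯_d has
-- (internal nodes) + e (total excess) edges, so the trees to be counted are those with
-- k + 1 internal nodes and excess n - k.  Let #(s, r, m) count the forests of r such trees
-- with s internal nodes and excess m in total: the first tree is a leaf, or its root, with
-- 1 + e a children, is deleted and the children join the remaining trees.  The resulting
-- recursion is solved by induction on s, with rising factorials x↑t:
--   (s + 1)! s! · #(s + 1, r, m) = r · (r + e m + 1)↑s · (m + 1)↑s,
-- and for r = 1, s = k, m = n - k the right-hand side is (k + 1)! k! N_d(n, k).

open import Defs
open import Data.Nat using (ℕ; suc; _*_; _≤_)
open import Data.Fin using (Fin)
open import Data.Product using (Σ; _×_)
open import Function.Bundles using (_↔_)
open import Relation.Binary.PropositionalEquality using (_≡_)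

open import Data.Nat using (zero; _+_; _∸_; _<_; _!; NonZero; _≤?_; s≤s; z≤n)
open import Data.Nat.Properties
open import Data.Nat.Combinatorics using (_C_; nCn≡1; nCk+nC[k+1]≡[n+1]C[k+1]; k>n⇒nCk≡0)
open import Data.Nat.Divisibility using (_∣_; divides)
open import Data.Nat.DivMod using (_/_; m*[n/m]≡n; m*n/n≡m)
open import Data.Nat.Tactic.RingSolver using (solve-∀)
import Data.Integer as ℤ
import Data.Integer.Properties as ℤP
import Data.Integer.Tactic.RingSolver as ℤ-Solver
open import Algebra.Properties.AbelianGroup ℤP.+-0-abelianGroup using (∙-cancelʳ)
open import Data.List using (List; []; _∷_; length; _++_; take; drop)
open import Data.List.Properties using (length-++; take++drop≡id; length-take; length-drop)
open import Data.Product using (_,_; proj₁; proj₂)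
open import Data.Sum using (_⊎_; inj₁; inj₂)
open import Data.Sum.Function.Propositional using (_⊎-↔_)
open import Data.Unit using (⊤; tt)
open import Data.Unit.Properties using (⊤-irrelevant)
open import Data.Empty using (⊥-elim)
open import Data.Fin.Properties using (+↔⊎; 1↔⊤)
open import Function.Bundles using (_⇔_; mk⇔; mk↔ₛ′; Equivalence)
open import Function.Properties.Inverse using (↔-trans; ↔-sym)
open import Relation.Nullary using (¬_; Dec; yes; no)
open import Relation.Nullary.Irrelevant using (Irrelevant)
open import Axiom.UniquenessOfIdentityProofs using (module Decidable⇒UIP)
open import Relation.Binary.PropositionalEquality using (refl; sym; trans; cong; cong₂; subst; module ≡-Reasoning)
open ≡-Reasoning

×-irrelevant : {A B : Set} → Irrelevant A → Irrelevant B → Irrelevant (A × B)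
×-irrelevant irrA irrB (a , b) (a′ , b′) = cong₂ _,_ (irrA a a′) (irrB b b′)

Σ-≡-irrelevant : {A : Set} {P : A → Set} → (∀ x → Irrelevant (P x)) → {p q : Σ A P} → proj₁ p ≡ proj₁ q → p ≡ q
Σ-≡-irrelevant irr {x , p} {.x , q} refl = cong (x ,_) (irr x p q)

Fin0↔ : {A : Set} → ¬ A → Fin 0 ↔ A
Fin0↔ ¬a = mk↔ₛ′ (λ ()) (λ a → ⊥-elim (¬a a)) (λ a → ⊥-elim (¬a a)) (λ ())

take-length-++ : {A : Set} (xs ys : List A) → take (length xs) (xs ++ ys) ≡ xs
take-length-++ []       ys = refl
take-length-++ (x ∷ xs) ys = cong (x ∷_) (take-length-++ xs ys)

drop-length-++ : {A : Set} (xs ys : List A) → drop (length xs) (xs ++ ys) ≡ ys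
drop-length-++ []       ys = refl
drop-length-++ (x ∷ xs) ys = drop-length-++ xs ys

infixl 8 _↑_

_↑_ : ℕ → ℕ → ℕ
x ↑ zero  = 1
x ↑ suc k = x * (suc x ↑ k)

↑-sucʳ : ∀ x k → x ↑ suc k ≡ x ↑ k * (x + k)
↑-sucʳ x zero    = trans (*-identityʳ x) (sym (trans (*-identityˡ _) (+-identityʳ x)))
↑-sucʳ x (suc k) = begin
  x * (suc x ↑ suc k)            ≡⟨ cong (x *_) (↑-sucʳ (suc x) k) ⟩
  x * (suc x ↑ k * (suc x + k))  ≡⟨ *-assoc x _ _ ⟨
  x ↑ suc k * suc (x + k)        ≡⟨ cong (x ↑ suc k *_) (+-suc x k) ⟨
  x ↑ suc k * (x + suc k)        ∎

1↑k≡k! : ∀ k → 1 ↑ k ≡ k !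
1↑k≡k! zero    = refl
1↑k≡k! (suc k) = begin
  1 ↑ suc k        ≡⟨ ↑-sucʳ 1 k ⟩
  1 ↑ k * suc k    ≡⟨ cong (_* suc k) (1↑k≡k! k) ⟩
  k ! * suc k      ≡⟨ *-comm (k !) (suc k) ⟩
  suc k !          ∎

k!*[a+k]Ck≡[1+a]↑k : ∀ a k → k ! * ((a + k) C k) ≡ suc a ↑ k
k!*[a+k]Ck≡[1+a]↑k a       zero    = refl
k!*[a+k]Ck≡[1+a]↑k zero    (suc k) = begin
  suc k ! * (suc k C suc k)  ≡⟨ cong (suc k ! *_) (nCn≡1 (suc k)) ⟩
  suc k ! * 1                ≡⟨ *-identityʳ _ ⟩
  suc k !                    ≡⟨ 1↑k≡k! (suc k) ⟨
  1 ↑ suc k                  ∎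
k!*[a+k]Ck≡[1+a]↑k (suc a) (suc k) = begin
  suc k ! * ((suc a + suc k) C suc k)
    ≡⟨ cong (λ n → suc k ! * (n C suc k)) (+-suc (suc a) k) ⟩
  suc k ! * (suc (suc a + k) C suc k)
    ≡⟨ cong (suc k ! *_) (nCk+nC[k+1]≡[n+1]C[k+1] (suc a + k) k) ⟨
  suc k ! * ((suc a + k) C k + (suc a + k) C suc k)
    ≡⟨ *-distribˡ-+ (suc k !) _ _ ⟩
  suc k * k ! * ((suc a + k) C k) + suc k ! * ((suc a + k) C suc k)
    ≡⟨ cong₂ _+_ (*-assoc (suc k) (k !) _) (cong (λ n → suc k ! * (n C suc k)) (sym (+-suc a k))) ⟩
  suc k * (k ! * ((suc a + k) C k)) + suc k ! * ((a + suc k) C suc k)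
    ≡⟨ cong₂ _+_ (cong (suc k *_) (k!*[a+k]Ck≡[1+a]↑k (suc a) k)) (k!*[a+k]Ck≡[1+a]↑k a (suc k)) ⟩
  suc k * suc (suc a) ↑ k + suc a * suc (suc a) ↑ k
    ≡⟨ collect a k (suc (suc a) ↑ k) ⟩
  suc (suc a) ↑ k * (suc (suc a) + k)
    ≡⟨ ↑-sucʳ (suc (suc a)) k ⟨
  suc (suc a) ↑ suc k ∎
  where
  collect : ∀ a k X → suc k * X + suc a * X ≡ X * (suc (suc a) + k)
  collect = solve-∀

module Counting (e : ℕ) where

  -- forests s r m = #(s, r, m) (see Trees.Forest), and
  -- expansions s p m = Σ_{a ≤ m} forests s (p + e a) (m ∸ a).
  mutual
    forests : ℕ → ℕ → ℕ → ℕ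
    forests zero    zero    zero    = 1
    forests zero    zero    (suc m) = 0
    forests (suc s) zero    m       = 0
    forests zero    (suc r) m       = forests zero r m
    forests (suc s) (suc r) m       = forests (suc s) r m + expansions s (suc r) m

    expansions : ℕ → ℕ → ℕ → ℕ
    expansions s p zero    = forests s p zero
    expansions s p (suc m) = forests s p (suc m) + expansions s (p + e) m

  forests₀-zero : ∀ p → forests 0 p 0 ≡ 1
  forests₀-zero zero    = refl
  forests₀-zero (suc p) = forests₀-zero p

  forests₀-suc : ∀ p m → forests 0 p (suc m) ≡ 0
  forests₀-suc zero    m = refl
  forests₀-suc (suc p) m = forests₀-suc p m

  expansions₀ : ∀ p m → expansions 0 p m ≡ 1
  expansions₀ p zero    = forests₀-zero p
  expansions₀ p (suc m) = cong₂ _+_ (forests₀-suc p m) (expansions₀ (p + e) m)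

  forests₁ : ∀ p m → forests 1 p m ≡ p
  forests₁ zero    m = refl
  forests₁ (suc p) m = trans (cong₂ _+_ (forests₁ p m) (expansions₀ (suc p) m)) (+-comm p 1)

  [2+t]!*[1+t]!*x≡[2+t]*[1+t]*[[1+t]!*t!*x] : ∀ t X → suc (suc t) ! * suc t ! * X ≡ suc (suc t) * suc t * (suc t ! * t ! * X)
  [2+t]!*[1+t]!*x≡[2+t]*[1+t]*[[1+t]!*t!*x] t X = rearrange t (suc t !) (t !) X
    where
    rearrange : ∀ t a b X → suc (suc t) * a * (suc t * b) * X ≡ suc (suc t) * suc t * (a * b * X)
    rearrange = solve-∀

  mutual
    forests-closed : ∀ t p m →
      suc t ! * t ! * forests (suc t) p m ≡ p * suc (p + e * m) ↑ t * suc m ↑ t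
    forests-closed zero    p       m = begin
      forests 1 p m + 0  ≡⟨ +-identityʳ _ ⟩
      forests 1 p m      ≡⟨ forests₁ p m ⟩
      p                  ≡⟨ trans (*-identityʳ _) (*-identityʳ p) ⟨
      p * 1 * 1          ∎
    forests-closed (suc t) zero    m = *-zeroʳ (suc (suc t) ! * suc t !)
    forests-closed (suc t) (suc p) m = begin
      F * (forests (suc (suc t)) p m + expansions (suc t) (suc p) m)
        ≡⟨ *-distribˡ-+ F _ _ ⟩
      F * forests (suc (suc t)) p m + F * expansions (suc t) (suc p) m
        ≡⟨ cong₂ _+_ (forests-closed (suc t) p m) (expansions-closed t (suc p) m) ⟩
      p * (suc (p + e * m) * A) * B + (suc p * suc (suc t) + e * m) * A * B
        ≡⟨ collect p e m t A B ⟩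
      suc p * (A * (suc (suc (p + e * m)) + t)) * B
        ≡⟨ cong (λ x → suc p * x * B) (↑-sucʳ (suc (suc (p + e * m))) t) ⟨
      suc p * suc (suc p + e * m) ↑ suc t * B ∎
      where
      F = suc (suc t) ! * suc t !
      A = suc (suc (p + e * m)) ↑ t
      B = suc m ↑ suc t
      collect : ∀ p e m t A B → p * (suc (p + e * m) * A) * B + (suc p * suc (suc t) + e * m) * A * B
                                ≡ suc p * (A * (suc (suc (p + e * m)) + t)) * B
      collect = solve-∀

    expansions-closed : ∀ t p m →
      suc (suc t) ! * suc t ! * expansions (suc t) p m
        ≡ (p * suc (suc t) + e * m) * suc (p + e * m) ↑ t * suc m ↑ suc t
    expansions-closed t p zero    = begin
      suc (suc t) ! * suc t ! * forests (suc t) p 0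
        ≡⟨ [2+t]!*[1+t]!*x≡[2+t]*[1+t]*[[1+t]!*t!*x] t _ ⟩
      suc (suc t) * suc t * (suc t ! * t ! * forests (suc t) p 0)
        ≡⟨ cong (suc (suc t) * suc t *_) (forests-closed t p 0) ⟩
      suc (suc t) * suc t * (p * A * 1 ↑ t)
        ≡⟨ collect p e t A (1 ↑ t) ⟩
      (p * suc (suc t) + e * 0) * A * (1 ↑ t * (1 + t))
        ≡⟨ cong (λ x → (p * suc (suc t) + e * 0) * A * x) (↑-sucʳ 1 t) ⟨
      (p * suc (suc t) + e * 0) * A * 1 ↑ suc t ∎
      where
      A = suc (p + e * 0) ↑ t
      collect : ∀ p e t A B → suc (suc t) * suc t * (p * A * B) ≡ (p * suc (suc t) + e * 0) * A * (B * (1 + t))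
      collect = solve-∀
    expansions-closed t p (suc m) = begin
      F * (forests (suc t) p (suc m) + expansions (suc t) (p + e) m)
        ≡⟨ *-distribˡ-+ F _ _ ⟩
      F * forests (suc t) p (suc m) + F * expansions (suc t) (p + e) m
        ≡⟨ cong₂ _+_ (trans ([2+t]!*[1+t]!*x≡[2+t]*[1+t]*[[1+t]!*t!*x] t _) (cong (suc (suc t) * suc t *_) (forests-closed t p (suc m))))
                     (expansions-closed t (p + e) m) ⟩
      suc (suc t) * suc t * (p * A * B)
        + ((p + e) * suc (suc t) + e * m) * suc (p + e + e * m) ↑ t * (suc m * B)
        ≡⟨ cong (λ x → suc (suc t) * suc t * (p * A * B) + ((p + e) * suc (suc t) + e * m) * suc x ↑ t * (suc m * B))
                (trans (+-assoc p e (e * m)) (cong (p +_) (sym (*-suc e m)))) ⟩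
      suc (suc t) * suc t * (p * A * B) + ((p + e) * suc (suc t) + e * m) * A * (suc m * B)
        ≡⟨ collect p e m t A B ⟩
      (p * suc (suc t) + e * suc m) * A * (B * (suc (suc m) + t))
        ≡⟨ cong ((p * suc (suc t) + e * suc m) * A *_) (↑-sucʳ (suc (suc m)) t) ⟨
      (p * suc (suc t) + e * suc m) * A * suc (suc m) ↑ suc t ∎
      where
      F = suc (suc t) ! * suc t !
      A = suc (p + e * suc m) ↑ t
      B = suc (suc m) ↑ t
      collect : ∀ p e m t A B → suc (suc t) * suc t * (p * A * B) + ((p + e) * suc (suc t) + e * m) * A * (suc m * B)
                                ≡ (p * suc (suc t) + e * suc m) * A * (B * (suc (suc m) + t))
      collect = solve-∀

  forests-binomial : ∀ k m →
    suc (k + m) * forests (suc k) 1 m ≡ (suc (k + m) C suc k) * ((suc (e * m) + k) C k)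
  forests-binomial k m = *-cancelˡ-≡ _ _ (suc k ! * k !) {{suc k !* k !≢0}} (begin
    suc k ! * k ! * (suc (k + m) * forests (suc k) 1 m)
      ≡⟨ swap (suc k ! * k !) (suc (k + m)) _ ⟩
    suc (k + m) * (suc k ! * k ! * forests (suc k) 1 m)
      ≡⟨ cong (suc (k + m) *_) (forests-closed k 1 m) ⟩
    suc (k + m) * (1 * A * B)
      ≡⟨ collect k m A B ⟩
    A * (B * (suc m + k))
      ≡⟨ cong (A *_) (↑-sucʳ (suc m) k) ⟨
    A * suc m ↑ suc k
      ≡⟨ cong₂ _*_ (k!*[a+k]Ck≡[1+a]↑k (suc (e * m)) k) (k!*[a+k]Ck≡[1+a]↑k m (suc k)) ⟨
    k ! * ((suc (e * m) + k) C k) * (suc k ! * ((m + suc k) C suc k))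
      ≡⟨ cong (λ n → k ! * ((suc (e * m) + k) C k) * (suc k ! * (n C suc k))) m+suc-k≡suc[k+m] ⟩
    k ! * ((suc (e * m) + k) C k) * (suc k ! * (suc (k + m) C suc k))
      ≡⟨ regroup (k !) (suc k !) ((suc (e * m) + k) C k) (suc (k + m) C suc k) ⟩
    suc k ! * k ! * ((suc (k + m) C suc k) * ((suc (e * m) + k) C k)) ∎)
    where
    A = suc (suc (e * m)) ↑ k
    B = suc m ↑ k
    m+suc-k≡suc[k+m] : m + suc k ≡ suc (k + m)
    m+suc-k≡suc[k+m] = trans (+-suc m k) (cong suc (+-comm m k))
    swap : ∀ a b c → a * (b * c) ≡ b * (a * c)
    swap = solve-∀
    collect : ∀ k m A B → suc (k + m) * (1 * A * B) ≡ A * (B * (suc m + k))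
    collect = solve-∀
    regroup : ∀ a b c d → a * c * (b * d) ≡ b * a * (d * c)
    regroup = solve-∀

NdNumerator≡0 : ∀ d {n k} → n < k → NdNumerator d n k ≡ 0
NdNumerator≡0 d {n} {k} n<k = cong (_* ((n + (n ∸ k) * (d ∸ 2) + 1) C k)) (k>n⇒nCk≡0 (s≤s n<k))

NdNumerator-k+m : ∀ d' k m → NdNumerator (suc (suc d')) (k + m) k ≡ (suc (k + m) C suc k) * ((suc (suc d' * m) + k) C k)
NdNumerator-k+m d' k m = cong (λ x → (suc (k + m) C suc k) * (x C k)) (begin
  k + m + (k + m ∸ k) * d' + 1  ≡⟨ cong (λ y → k + m + y * d' + 1) (m+n∸m≡n k m) ⟩
  k + m + m * d' + 1            ≡⟨ rearrange k m d' ⟩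
  suc (suc d' * m) + k          ∎)
  where
  rearrange : ∀ k m d' → k + m + m * d' + 1 ≡ suc (suc d' * m) + k
  rearrange = solve-∀

module _ where
  open ℤ using (+_)

  -- The edge count required by TreesWith, freed of integer subtraction.
  edge-equation⇔ : ∀ e n k E →
    (+ E ≡ (+ n ℤ.- + k) ℤ.* (+ suc e ℤ.- + 1) ℤ.+ + k ℤ.+ + 1) ⇔ (E + e * k ≡ suc k + e * n)
  edge-equation⇔ e n k E = mk⇔
    (λ h → ℤP.+-injective (trans (cong (λ x → x ℤ.+ + (e * k)) h) key))
    (λ h → ∙-cancelʳ (+ (e * k)) (+ E) Z (trans (cong +_ h) (sym key)))
    where
    Z = (+ n ℤ.- + k) ℤ.* (+ suc e ℤ.- + 1) ℤ.+ + k ℤ.+ + 1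
    identity : ∀ N K E → (N ℤ.- K) ℤ.* ((+ 1 ℤ.+ E) ℤ.- + 1) ℤ.+ K ℤ.+ + 1 ℤ.+ E ℤ.* K ≡ + 1 ℤ.+ K ℤ.+ E ℤ.* N
    identity = ℤ-Solver.solve-∀
    key : Z ℤ.+ + (e * k) ≡ + (suc k + e * n)
    key = begin
      Z ℤ.+ + (e * k)              ≡⟨ cong (ℤ._+_ Z) (ℤP.pos-* e k) ⟩
      Z ℤ.+ + e ℤ.* + k            ≡⟨ identity (+ n) (+ k) (+ e) ⟩
      + 1 ℤ.+ + k ℤ.+ + e ℤ.* + n  ≡⟨ cong (ℤ._+_ (+ suc k)) (ℤP.pos-* e n) ⟨
      + (suc k + e * n)            ∎

internalL-++ : ∀ xs ys → internalL (xs ++ ys) ≡ internalL xs + internalL ys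
internalL-++ []       ys = refl
internalL-++ (x ∷ xs) ys = trans (cong (internal x +_) (internalL-++ xs ys)) (sym (+-assoc (internal x) _ _))

AllInternalOKL-++ : ∀ {d} xs {ys} → AllInternalOKL d xs → AllInternalOKL d ys → AllInternalOKL d (xs ++ ys)
AllInternalOKL-++ []       _          okys = okys
AllInternalOKL-++ (x ∷ xs) (okx , ok) okys = okx , AllInternalOKL-++ xs ok okys

AllInternalOKL-++⁻ : ∀ {d} xs {ys} → AllInternalOKL d (xs ++ ys) → AllInternalOKL d xs × AllInternalOKL d ys
AllInternalOKL-++⁻ []       ok         = tt , ok
AllInternalOKL-++⁻ (x ∷ xs) (okx , ok) = let okxs , okys = AllInternalOKL-++⁻ xs ok in (okx , okxs) , okys

module Trees (e : ℕ) .{{_ : NonZero e}} where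

  open Counting e using (forests; expansions)

  mutual
    excess : Tree → ℕ
    excess (node [])       = 0
    excess (node (c ∷ cs)) = length cs / e + excessL (c ∷ cs)

    excessL : List Tree → ℕ
    excessL []       = 0
    excessL (t ∷ ts) = excess t + excessL ts

  excessL-++ : ∀ xs ys → excessL (xs ++ ys) ≡ excessL xs + excessL ys
  excessL-++ []       ys = refl
  excessL-++ (x ∷ xs) ys = trans (cong (excess x +_) (excessL-++ xs ys)) (sym (+-assoc (excess x) _ _))

  mutual
    edges≡internal+e*excess : ∀ t → AllInternalOK (suc e) t → edges t ≡ internal t + e * excess t
    edges≡internal+e*excess (node [])       _          = sym (*-zeroʳ e)
    edges≡internal+e*excess (node (c ∷ cs)) (e∣cs , ok) = begin
      suc (length cs + edgesL (c ∷ cs))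
        ≡⟨ cong₂ (λ l E → suc (l + E)) (m*[n/m]≡n e∣cs) (sym (edgesL≡internalL+e*excessL (c ∷ cs) ok)) ⟨
      suc (e * a + (internalL (c ∷ cs) + e * excessL (c ∷ cs)))
        ≡⟨ collect e a (internalL (c ∷ cs)) (excessL (c ∷ cs)) ⟩
      suc (internalL (c ∷ cs) + e * (a + excessL (c ∷ cs))) ∎
      where
      a = length cs / e
      collect : ∀ e a I X → suc (e * a + (I + e * X)) ≡ suc (I + e * (a + X))
      collect = solve-∀

    edgesL≡internalL+e*excessL : ∀ ts → AllInternalOKL (suc e) ts → edgesL ts ≡ internalL ts + e * excessL ts
    edgesL≡internalL+e*excessL []       _         = sym (*-zeroʳ e)
    edgesL≡internalL+e*excessL (t ∷ ts) (ok , oks) = begin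
      edges t + edgesL ts
        ≡⟨ cong₂ _+_ (edges≡internal+e*excess t ok) (edgesL≡internalL+e*excessL ts oks) ⟩
      (internal t + e * excess t) + (internalL ts + e * excessL ts)
        ≡⟨ interchange e (internal t) (excess t) (internalL ts) (excessL ts) ⟩
      (internal t + internalL ts) + e * (excess t + excessL ts) ∎
      where
      interchange : ∀ e i x I X → (i + e * x) + (I + e * X) ≡ (i + I) + e * (x + X)
      interchange = solve-∀

  ∣-irrelevant : ∀ {n} → Irrelevant (e ∣ n)
  ∣-irrelevant (divides q eq) (divides q′ eq′) with *-cancelʳ-≡ q q′ e (trans (sym eq) eq′)
  ... | refl = cong (divides q) (≡-irrelevant eq eq′)

  mutual
    AllInternalOK-irrelevant : ∀ t → Irrelevant (AllInternalOK (suc e) t)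
    AllInternalOK-irrelevant (node [])       = ⊤-irrelevant
    AllInternalOK-irrelevant (node (c ∷ cs)) = ×-irrelevant ∣-irrelevant (AllInternalOKL-irrelevant (c ∷ cs))

    AllInternalOKL-irrelevant : ∀ ts → Irrelevant (AllInternalOKL (suc e) ts)
    AllInternalOKL-irrelevant []       = ⊤-irrelevant
    AllInternalOKL-irrelevant (t ∷ ts) = ×-irrelevant (AllInternalOK-irrelevant t) (AllInternalOKL-irrelevant ts)

  IsForest : ℕ → ℕ → ℕ → List Tree → Set
  IsForest s r m ts = length ts ≡ r × internalL ts ≡ s × excessL ts ≡ m × AllInternalOKL (suc e) ts

  Forest : ℕ → ℕ → ℕ → Set
  Forest s r m = Σ (List Tree) (IsForest s r m)

  Expansion : ℕ → ℕ → ℕ → Set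
  Expansion s p m = Σ ℕ λ a → a ≤ m × Forest s (p + e * a) (m ∸ a)

  IsForest-irrelevant : ∀ s r m ts → Irrelevant (IsForest s r m ts)
  IsForest-irrelevant s r m ts =
    ×-irrelevant ≡-irrelevant (×-irrelevant ≡-irrelevant (×-irrelevant ≡-irrelevant (AllInternalOKL-irrelevant ts)))

  Forest-≡ : ∀ {s r m} {f g : Forest s r m} → proj₁ f ≡ proj₁ g → f ≡ g
  Forest-≡ = Σ-≡-irrelevant (IsForest-irrelevant _ _ _)

  Expansion-≡ : ∀ {s p m a a′ a≤m a′≤m} {f : Forest s (p + e * a) (m ∸ a)} {f′ : Forest s (p + e * a′) (m ∸ a′)} →
                a ≡ a′ → proj₁ f ≡ proj₁ f′ → _≡_ {A = Expansion s p m} (a , a≤m , f) (a′ , a′≤m , f′)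
  Expansion-≡ refl eq = cong₂ (λ le f → _ , le , f) (≤-irrelevant _ _) (Forest-≡ eq)

  resize : ∀ {s r r′ m} → r ≡ r′ → Forest s r m → Forest s r′ m
  resize eq (ts , l , rest) = ts , trans l eq , rest

  Forest-000↔⊤ : Forest 0 0 0 ↔ ⊤
  Forest-000↔⊤ = mk↔ₛ′ (λ _ → tt) (λ _ → [] , refl , refl , refl , tt) (λ _ → refl) (λ { ([] , _) → Forest-≡ refl })

  leaf∷ : ∀ {s r m} → Forest s r m → Forest s (suc r) m
  leaf∷ (ts , l , i , x , ok) = node [] ∷ ts , cong suc l , i , x , tt , ok

  Forest₀-suc↔ : ∀ r m → Forest 0 (suc r) m ↔ Forest 0 r m
  Forest₀-suc↔ r m = mk↔ₛ′ dropLeaf leaf∷ (λ _ → Forest-≡ refl) leaf∷-dropLeaf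
    where
    dropLeaf : Forest 0 (suc r) m → Forest 0 r m
    dropLeaf (node []      ∷ ts , l , i , x , _ , ok) = ts , suc-injective l , i , x , ok
    dropLeaf (node (_ ∷ _) ∷ _  , _ , () , _)
    leaf∷-dropLeaf : ∀ f → leaf∷ (dropLeaf f) ≡ f
    leaf∷-dropLeaf (node []      ∷ _ , _) = Forest-≡ refl
    leaf∷-dropLeaf (node (_ ∷ _) ∷ _ , _ , () , _)

  p+e*0≡p : ∀ p → p + e * 0 ≡ p
  p+e*0≡p p = trans (cong (p +_) (*-zeroʳ e)) (+-identityʳ p)

  p+e*[1+a]≡p+e+e*a : ∀ p a → p + e * suc a ≡ p + e + e * a
  p+e*[1+a]≡p+e+e*a p a = trans (cong (p +_) (*-suc e a)) (sym (+-assoc p e (e * a)))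

  Expansion-zero↔ : ∀ s p → Expansion s p 0 ↔ Forest s p 0
  Expansion-zero↔ s p = mk↔ₛ′
    (λ { (zero , z≤n , f) → resize (p+e*0≡p p) f })
    (λ f → 0 , z≤n , resize (sym (p+e*0≡p p)) f)
    (λ _ → Forest-≡ refl)
    (λ { (zero , z≤n , f) → Expansion-≡ refl refl })

  Expansion-suc↔ : ∀ s p m → Expansion s p (suc m) ↔ (Forest s p (suc m) ⊎ Expansion s (p + e) m)
  Expansion-suc↔ s p m = mk↔ₛ′ to from
    (λ { (inj₁ _) → cong inj₁ (Forest-≡ refl) ; (inj₂ _) → cong inj₂ (Expansion-≡ refl refl) })
    (λ { (zero , z≤n , _) → Expansion-≡ refl refl ; (suc a , s≤s _ , _) → Expansion-≡ refl refl })
    where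
    to : Expansion s p (suc m) → Forest s p (suc m) ⊎ Expansion s (p + e) m
    to (zero  , _       , f) = inj₁ (resize (p+e*0≡p p) f)
    to (suc a , s≤s a≤m , f) = inj₂ (a , a≤m , resize (p+e*[1+a]≡p+e+e*a p a) f)
    from : Forest s p (suc m) ⊎ Expansion s (p + e) m → Expansion s p (suc m)
    from (inj₁ f)             = 0 , z≤n , resize (sym (p+e*0≡p p)) f
    from (inj₂ (a , a≤m , f)) = suc a , s≤s a≤m , resize (sym (p+e*[1+a]≡p+e+e*a p a)) f

  module _ {s r m : ℕ} where

    expandRoot : Forest (suc s) (suc r) m → Forest (suc s) r m ⊎ Expansion s (suc r) m
    expandRoot (node []       ∷ ts , l , i , x , _ , ok) = inj₁ (ts , suc-injective l , i , x , ok)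
    expandRoot (node (c ∷ cs) ∷ ts , l , i , x , (e∣cs , okcs) , okts) =
      inj₂ (a , a≤m , (c ∷ cs) ++ ts , l′ , i′ , x′ , AllInternalOKL-++ (c ∷ cs) okcs okts)
      where
      a = length cs / e
      a+X≡m : a + excessL ((c ∷ cs) ++ ts) ≡ m
      a+X≡m = trans (cong (a +_) (excessL-++ (c ∷ cs) ts)) (trans (sym (+-assoc a _ _)) x)
      a≤m : a ≤ m
      a≤m = subst (a ≤_) a+X≡m (m≤m+n a _)
      l′ : length ((c ∷ cs) ++ ts) ≡ suc r + e * a
      l′ = cong suc (trans (length-++ cs) (trans (cong₂ _+_ (sym (m*[n/m]≡n e∣cs)) (suc-injective l)) (+-comm (e * a) r)))
      i′ : internalL ((c ∷ cs) ++ ts) ≡ s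
      i′ = trans (internalL-++ (c ∷ cs) ts) (suc-injective i)
      x′ : excessL ((c ∷ cs) ++ ts) ≡ m ∸ a
      x′ = trans (sym (m+n∸m≡n a _)) (cong (_∸ a) a+X≡m)

    module Graft (a : ℕ) (u : Tree) (us : List Tree) (l : suc (length us) ≡ suc r + e * a) where
      T = take (e * a) us
      D = drop (e * a) us

      |us|≡e*a+r : length us ≡ e * a + r
      |us|≡e*a+r = trans (suc-injective l) (+-comm r (e * a))

      |T|≡e*a : length T ≡ e * a
      |T|≡e*a = trans (length-take (e * a) us) (m≤n⇒m⊓n≡m (subst (e * a ≤_) (sym |us|≡e*a+r) (m≤m+n (e * a) r)))

      |D|≡r : length D ≡ r
      |D|≡r = trans (length-drop (e * a) us) (trans (cong (_∸ e * a) |us|≡e*a+r) (m+n∸m≡n (e * a) r))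

      |T|/e≡a : length T / e ≡ a
      |T|/e≡a = trans (cong (_/ e) (trans |T|≡e*a (*-comm e a))) (m*n/n≡m a e)

      split : (u ∷ T) ++ D ≡ u ∷ us
      split = cong (u ∷_) (take++drop≡id (e * a) us)

      graft : a ≤ m → IsForest s (suc r + e * a) (m ∸ a) (u ∷ us) → Forest (suc s) (suc r) m
      graft a≤m (_ , i , x , ok) =
        node (u ∷ T) ∷ D , cong suc |D|≡r , i′ , x′ , (divides a (trans |T|≡e*a (*-comm e a)) , proj₁ ok′) , proj₂ ok′
        where
        ok′ = AllInternalOKL-++⁻ (u ∷ T) (subst (AllInternalOKL (suc e)) (sym split) ok)
        i′ : suc (internalL (u ∷ T)) + internalL D ≡ suc s
        i′ = cong suc (trans (sym (internalL-++ (u ∷ T) D)) (trans (cong internalL split) i))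
        x′ : (length T / e + excessL (u ∷ T)) + excessL D ≡ m
        x′ = begin
          (length T / e + excessL (u ∷ T)) + excessL D  ≡⟨ +-assoc (length T / e) _ _ ⟩
          length T / e + (excessL (u ∷ T) + excessL D)  ≡⟨ cong₂ _+_ |T|/e≡a (trans (sym (excessL-++ (u ∷ T) D)) (trans (cong excessL split) x)) ⟩
          a + (m ∸ a)                                   ≡⟨ m+[n∸m]≡n a≤m ⟩
          m                                             ∎

    collapseRoot : Forest (suc s) r m ⊎ Expansion s (suc r) m → Forest (suc s) (suc r) m
    collapseRoot (inj₁ f)                         = leaf∷ f
    collapseRoot (inj₂ (a , a≤m , []     , () , _))
    collapseRoot (inj₂ (a , a≤m , u ∷ us , F))    = Graft.graft a u us (proj₁ F) a≤m F

    Forest-firstTree↔ : Forest (suc s) (suc r) m ↔ (Forest (suc s) r m ⊎ Expansion s (suc r) m)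
    Forest-firstTree↔ = mk↔ₛ′ expandRoot collapseRoot expand-collapse collapse-expand
      where
      expand-collapse : ∀ y → expandRoot (collapseRoot y) ≡ y
      expand-collapse (inj₁ _)                        = cong inj₁ (Forest-≡ refl)
      expand-collapse (inj₂ (a , a≤m , []     , () , _))
      expand-collapse (inj₂ (a , a≤m , u ∷ us , l , _)) = cong inj₂ (Expansion-≡ (Graft.|T|/e≡a a u us l) (Graft.split a u us l))

      regraft : ∀ c cs ts {n} → e * n ≡ length cs →
                node (c ∷ take (e * n) (cs ++ ts)) ∷ drop (e * n) (cs ++ ts) ≡ node (c ∷ cs) ∷ ts
      regraft c cs ts eq rewrite eq = cong₂ (λ xs ys → node (c ∷ xs) ∷ ys) (take-length-++ cs ts) (drop-length-++ cs ts)

      collapse-expand : ∀ f → collapseRoot (expandRoot f) ≡ f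
      collapse-expand (node []       ∷ _  , _)                        = Forest-≡ refl
      collapse-expand (node (c ∷ cs) ∷ ts , _ , _ , _ , (e∣cs , _) , _) = Forest-≡ (regraft c cs ts (m*[n/m]≡n e∣cs))

  mutual
    Fin-forests↔Forest : ∀ s r m → Fin (forests s r m) ↔ Forest s r m
    Fin-forests↔Forest zero    zero    zero    = ↔-trans 1↔⊤ (↔-sym Forest-000↔⊤)
    Fin-forests↔Forest zero    zero    (suc m) = Fin0↔ (λ { ([] , _ , _ , () , _) })
    Fin-forests↔Forest (suc s) zero    m       = Fin0↔ (λ { ([] , _ , () , _) })
    Fin-forests↔Forest zero    (suc r) m       = ↔-trans (Fin-forests↔Forest zero r m) (↔-sym (Forest₀-suc↔ r m))
    Fin-forests↔Forest (suc s) (suc r) m       =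
      ↔-trans +↔⊎ (↔-trans (Fin-forests↔Forest (suc s) r m ⊎-↔ Fin-expansions↔Expansion s (suc r) m) (↔-sym Forest-firstTree↔))

    Fin-expansions↔Expansion : ∀ s p m → Fin (expansions s p m) ↔ Expansion s p m
    Fin-expansions↔Expansion s p zero    = ↔-trans (Fin-forests↔Forest s p zero) (↔-sym (Expansion-zero↔ s p))
    Fin-expansions↔Expansion s p (suc m) =
      ↔-trans +↔⊎ (↔-trans (Fin-forests↔Forest s p (suc m) ⊎-↔ Fin-expansions↔Expansion s (p + e) m) (↔-sym (Expansion-suc↔ s p m)))

  module _ where
    open ℤ using (+_)

    edgeCondition⇔ : ∀ {n k} t → AllInternalOK (suc e) t → internal t ≡ suc k →
      (+ edges t ≡ (+ n ℤ.- + k) ℤ.* (+ suc e ℤ.- + 1) ℤ.+ + k ℤ.+ + 1) ⇔ (k + excess t ≡ n)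
    edgeCondition⇔ {n} {k} t ok it = mk⇔
      (λ h → *-cancelˡ-≡ _ _ e (+-cancelˡ-≡ (suc k) _ _ (trans (sym edges+e*k) (Equivalence.to edge-equation h))))
      (λ h → Equivalence.from edge-equation (trans edges+e*k (cong (λ y → suc k + e * y) h)))
      where
      edge-equation = edge-equation⇔ e n k (edges t)
      rearrange : ∀ a e k x → a + e * x + e * k ≡ a + e * (k + x)
      rearrange = solve-∀
      edges+e*k : edges t + e * k ≡ suc k + e * (k + excess t)
      edges+e*k = begin
        edges t + e * k                     ≡⟨ cong (_+ e * k) (edges≡internal+e*excess t ok) ⟩
        internal t + e * excess t + e * k   ≡⟨ cong (λ i → i + e * excess t + e * k) it ⟩
        suc k + e * excess t + e * k        ≡⟨ rearrange (suc k) e k (excess t) ⟩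
        suc k + e * (k + excess t)          ∎

    TreesWith↔Forest : ∀ {n k m} → k + m ≡ n → TreesWith (suc e) n k ↔ Forest (suc k) 1 m
    TreesWith↔Forest {n} {k} {m} k+m≡n = mk↔ₛ′ to from to-from from-to
      where
      to : TreesWith (suc e) n k → Forest (suc k) 1 m
      to (t , (_ , ok) , edges≡ , it) =
        t ∷ [] , refl , trans (+-identityʳ _) it , trans (+-identityʳ _) excess≡m , ok , tt
        where
        excess≡m : excess t ≡ m
        excess≡m = +-cancelˡ-≡ k _ _ (trans (Equivalence.to (edgeCondition⇔ t ok it) edges≡) (sym k+m≡n))

      from : Forest (suc k) 1 m → TreesWith (suc e) n k
      from ([]        , () , _)
      from (_ ∷ _ ∷ _ , () , _)
      from (t ∷ []    , _ , i , x , ok , _) =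
        t , (subst (1 ≤_) (sym it) (s≤s z≤n) , ok) , Equivalence.from (edgeCondition⇔ t ok it) k+excess≡n , it
        where
        it = trans (sym (+-identityʳ _)) i
        k+excess≡n = trans (cong (λ x → k + x) (trans (sym (+-identityʳ _)) x)) k+m≡n

      to-from : ∀ f → to (from f) ≡ f
      to-from ([]        , () , _)
      to-from (_ ∷ _ ∷ _ , () , _)
      to-from (_ ∷ []    , _)    = Forest-≡ refl

      from-to : ∀ w → from (to w) ≡ w
      from-to _ = Σ-≡-irrelevant (λ t → ×-irrelevant (×-irrelevant ≤-irrelevant (AllInternalOK-irrelevant t))
                                                     (×-irrelevant (Decidable⇒UIP.≡-irrelevant ℤP._≟_) ≡-irrelevant)) refl

    ¬TreesWith : ∀ {n k} → n < k → ¬ TreesWith (suc e) n k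
    ¬TreesWith n<k (t , (_ , ok) , edges≡ , it) =
      <⇒≱ n<k (subst (_ ≤_) (Equivalence.to (edgeCondition⇔ t ok it) edges≡) (m≤m+n _ (excess t)))

theorem3p2 : (d n k : ℕ) → 2 ≤ d →
    Σ ℕ λ c → (Fin c ↔ TreesWith d n k) × (suc n * c ≡ NdNumerator d n k)
theorem3p2 zero          n k ()
theorem3p2 (suc zero)    n k (s≤s ())
theorem3p2 (suc (suc d')) n k _ = count (k ≤? n)
  where
  open Counting (suc d') using (forests; forests-binomial)
  open Trees (suc d') using (Fin-forests↔Forest; TreesWith↔Forest; ¬TreesWith)

  count : Dec (k ≤ n) →
    Σ ℕ λ c → (Fin c ↔ TreesWith (suc (suc d')) n k) × (suc n * c ≡ NdNumerator (suc (suc d')) n k)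
  count (no k≰n) =
    0 , Fin0↔ (¬TreesWith (≰⇒> k≰n)) , trans (*-zeroʳ (suc n)) (sym (NdNumerator≡0 (suc (suc d')) (≰⇒> k≰n)))
  count (yes k≤n) =
    forests (suc k) 1 m ,
    ↔-trans (Fin-forests↔Forest (suc k) 1 m) (↔-sym (TreesWith↔Forest k+m≡n)) ,
    subst (λ n → suc n * forests (suc k) 1 m ≡ NdNumerator (suc (suc d')) n k) k+m≡n
          (trans (forests-binomial k m) (sym (NdNumerator-k+m d' k m)))
    where
    m = n ∸ k
    k+m≡n = m+[n∸m]≡n k≤n
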